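{- Let $P$ and $Q$ be posets on disjoint ground sets. Then $\mathrm{QLB}(P\oplus Q)=\mathrm{QLB}(P)+\mathrm{QLB}(Q)$.
   Context: For a poset $R$ on an $n$-element ground set $A$: a linear extension is a bijection $\sigma:A\to[n]$ with $i\le_R j\implies\sigma(i)\le\sigma(j)$; $\Delta(R)$ is the set of linear extensions. For $y\in\mathbb{R}^A$ with $i\le_R j\implies y_i\le y_j$, $d_i(y)=y_i$ if $i$ is minimal in $R$, and otherwise $d_i(y)=\min\{y_i-y_j : j\ne i,\ j\le_R i\}$; for $\sigma\in\Delta(R)$, $d_i(\sigma):=d_i((\sigma(a))_{a\in A})$. $H_q=\sum_{m=1}^q1/m$, $H_0=0$. $\mathrm{QLB}(R)=\mathbb{E}_\sigma\left[\sum_{i\in A}H_{d_i(\sigma)-1}\right]$ with $\sigma$ uniform on $\Delta(R)$. The series composition $P\oplus Q$ is the poset on the union of the ground sets with $x\le y$ iff $x\le_P y$, or $x\le_Q y$, or $x\in P$ and $y\in Q$. -}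

module Defs where

open import Level using (0ℓ)
open import Data.Nat as ℕ using (ℕ; zero; suc; _∸_; _+_; _⊓_)
open import Data.Integer using (+_)
open import Data.Fin using (Fin; toℕ; splitAt)
open import Data.Fin.Properties using (_≟_; all?; any?)
open import Data.Sum using (_⊎_; inj₁; inj₂)
open import Data.Unit using (⊤; tt)
open import Data.Empty using (⊥)
open import Data.Product using (_×_; _,_; ∃)
open import Data.List using (List; []; _∷_; filter; map; length; foldr; concatMap; allFin; [_])
open import Data.Vec using (Vec; lookup) renaming ([] to []ᵥ; _∷_ to _∷ᵥ_)
open import Data.Rational using (ℚ; 0ℚ; _/_) renaming (_+_ to _+ℚ_; _*_ to _*ℚ_)
open import Relation.Nullary using (Dec; yes; no; ¬_)
open import Relation.Nullary.Decidable using (_×-dec_; _→-dec_; ¬?)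
open import Relation.Binary using (Rel; Decidable; IsPartialOrder)
open import Relation.Binary.PropositionalEquality using (_≡_)

record DecRel (n : ℕ) : Set₁ where
  field
    _≤ᴿ_ : Rel (Fin n) 0ℓ
    _≤?_ : Decidable _≤ᴿ_
open DecRel public

IsPoset : ∀ {n} → DecRel n → Set
IsPoset R = IsPartialOrder _≡_ (_≤ᴿ_ R)

-- Series composition P ⊕ Q on the disjoint union Fin (m + n)
-- (the first m elements are P's ground set, the last n are Q's).
SerRel : ∀ {m n} → DecRel m → DecRel n → Fin m ⊎ Fin n → Fin m ⊎ Fin n → Set
SerRel P Q (inj₁ a) (inj₁ b) = _≤ᴿ_ P a b
SerRel P Q (inj₂ a) (inj₂ b) = _≤ᴿ_ Q a b
SerRel P Q (inj₁ a) (inj₂ b) = ⊤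
SerRel P Q (inj₂ a) (inj₁ b) = ⊥

serRel? : ∀ {m n} (P : DecRel m) (Q : DecRel n) → ∀ x y → Dec (SerRel P Q x y)
serRel? P Q (inj₁ a) (inj₁ b) = _≤?_ P a b
serRel? P Q (inj₂ a) (inj₂ b) = _≤?_ Q a b
serRel? P Q (inj₁ a) (inj₂ b) = yes tt
serRel? P Q (inj₂ a) (inj₁ b) = no (λ ())

_⊕_ : ∀ {m n} → DecRel m → DecRel n → DecRel (m + n)
_⊕_ {m} P Q = record
  { _≤ᴿ_ = λ x y → SerRel P Q (splitAt m x) (splitAt m y)
  ; _≤?_ = λ x y → serRel? P Q (splitAt m x) (splitAt m y) }

-- A map σ : A → [n]; σ i ∈ Fin n represents the value toℕ (σ i) + 1 ∈ {1..n}.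
val : ∀ {n} → (Fin n → Fin n) → Fin n → ℕ
val σ i = suc (toℕ (σ i))

IsLinExt : ∀ {n} → DecRel n → (Fin n → Fin n) → Set
IsLinExt R σ =
  ((i j : Fin _) → σ i ≡ σ j → i ≡ j) ×
  ((k : Fin _) → ∃ λ i → σ i ≡ k) ×
  ((i j : Fin _) → _≤ᴿ_ R i j → val σ i ℕ.≤ val σ j)

isLinExt? : ∀ {n} (R : DecRel n) (σ : Fin n → Fin n) → Dec (IsLinExt R σ)
isLinExt? R σ =
  all? (λ i → all? (λ j → (σ i ≟ σ j) →-dec (i ≟ j))) ×-dec
  (all? (λ k → any? (λ i → σ i ≟ k)) ×-dec
   all? (λ i → all? (λ j → (_≤?_ R i j) →-dec (val σ i ℕ.≤? val σ j))))

allTables : (k m : ℕ) → List (Vec (Fin m) k)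
allTables zero m = [ []ᵥ ]
allTables (suc k) m = concatMap (λ x → map (x ∷ᵥ_) (allTables k m)) (allFin m)

Δ : ∀ {n} → DecRel n → List (Vec (Fin n) n)
Δ {n} R = filter (λ t → isLinExt? R (lookup t)) (allTables n n)

preds : ∀ {n} → DecRel n → Fin n → List (Fin n)
preds {n} R i = filter (λ j → ¬? (j ≟ i) ×-dec _≤?_ R j i) (allFin n)

d : ∀ {n} → DecRel n → (Fin n → Fin n) → Fin n → ℕ
d R σ i with preds R i
... | [] = val σ i
... | j ∷ js = foldr (λ k acc → (val σ i ∸ val σ k) ⊓ acc) (val σ i ∸ val σ j) js

H : ℕ → ℚ
H zero = 0ℚ
H (suc q) = H q +ℚ (+ 1 / suc q)

sumℚ : List ℚ → ℚ
sumℚ = foldr _+ℚ_ 0ℚ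

-- Uniform average over a finite list (0 for the empty list; Δ(R) is never empty for a poset).
avg : List ℚ → ℚ
avg xs with length xs
... | zero = 0ℚ
... | suc k = sumℚ xs *ℚ (+ 1 / suc k)

QLB : ∀ {n} → DecRel n → ℚ
QLB {n} R = avg (map (λ t → sumℚ (map (λ i → H (d R (lookup t) i ∸ 1)) (allFin n))) (Δ R))

module Submission where

-- Write w_R(σ) = Σ_i H(d_i(σ) − 1), so that QLB(R) is the average of w_R over Δ(R).
--  1. d_i(σ) = σ(i) − max{σ(j) : j <_R i} (the maximum being 0 for minimal i)  [d-as-max].
--  2. The linear extensions of P ⊕ Q are exactly the stacks of a linear extension s of P
--     (on positions 1..m) and a linear extension t of Q (on positions m+1..m+n)
--     [stack-linExt, unstack-linExt, linExt-is-stack]; hence Δ(P ⊕ Q) is a permutation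
--     of the product list Δ(P) × Δ(Q)  [Δ-⊕].
--  3. In a stack, an element of P has the same predecessors and values as in s; an element
--     of Q has all of P below it, whose largest value is m, so by 1. its d-value is that in t.
--     Thus w_{P⊕Q}(stack s t) = w_P(s) + w_Q(t)  [weight-stack].
--  4. The average of f(x) + g(y) over a product of nonempty lists is avg f + avg g
--     [avg-cartesian]; Δ(P) and Δ(Q) are nonempty since every poset has a linear extension,
--     obtained by ranking elements by (size of downset, index)  [linExt-exists].

open import Level using (0ℓ)
open import Function using (_∘_; id; _⇔_; mk⇔; Equivalence)
open import Data.Empty using (⊥-elim)
open import Data.Unit using (tt)
open import Data.Product using (_×_; _,_; ∃; proj₁; proj₂)
open import Data.Sum as Sum using (_⊎_; inj₁; inj₂)
open import Data.Product.Relation.Binary.Lex.Strict using (×-Lex)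
import Data.Product.Relation.Binary.Lex.Strict as Lex
open import Data.Nat as ℕ
  using (ℕ; zero; suc; _+_; _*_; _∸_; _⊔_; _⊓_; _≤_; _<_; z≤n; s≤s)
import Data.Nat.Properties as ℕₚ
import Data.Integer as ℤ
import Data.Integer.Properties as ℤₚ
open import Data.Fin as Fin using (Fin; toℕ; fromℕ<; splitAt; join; _↑ˡ_; _↑ʳ_)
import Data.Fin.Properties as Finₚ
open import Data.Vec as Vec using (Vec; lookup) renaming (_∷_ to _∷ᵥ_)
import Data.Vec.Functional as VecF
import Data.Vec.Properties as Vecₚ
open import Data.List as List
  using (List; []; _∷_; _++_; map; foldr; filter; length; tabulate; allFin; cartesianProductWith)
import Data.List.Properties as Listₚ
open import Data.List.Relation.Unary.All as All using (All; []; _∷_)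
import Data.List.Relation.Unary.All.Properties as Allₚ
open import Data.List.Relation.Unary.Any as Any using (here; there)
open import Data.List.Membership.Propositional using (_∈_)
open import Data.List.Membership.Propositional.Properties
  using (∈-map⁺; ∈-allFin; ∈-filter⁺; ∈-filter⁻; ∈-cartesianProductWith⁺; ∈-cartesianProductWith⁻)
open import Data.List.Relation.Binary.Permutation.Propositional using (_↭_; ↭⇒↭ₛ)
open import Data.List.Relation.Unary.Unique.Propositional using (Unique)
import Data.List.Relation.Unary.Unique.Propositional.Properties as Uniqueₚ
import Data.List.Relation.Unary.AllPairs as AllPairs
open import Data.List.Relation.Binary.BagAndSetEquality using (∼bag⇒↭)
open import Data.List.Membership.Propositional.Properties.WithK using (unique∧set⇒bag)
import Data.List.Relation.Binary.Permutation.Propositional.Properties as Permₚ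
open import Data.List.Relation.Binary.Permutation.Setoid.Properties using (foldr-commMonoid)
open import Data.Rational using (ℚ; 0ℚ; 1ℚ; _/_; toℚᵘ) renaming (_+_ to _+ℚ_; _*_ to _*ℚ_)
import Data.Rational.Properties as ℚₚ
open import Data.Rational.Unnormalised using (mkℚᵘ; *≡*) renaming (_≃_ to _≃ᵘ_)
import Data.Rational.Unnormalised.Properties as ℚᵘₚ
open import Relation.Nullary using (yes; no; ¬_; ¬?)
open import Relation.Nullary.Decidable using (_×-dec_)
open import Relation.Unary using (Pred; Decidable)
open import Relation.Binary using (Rel; IsPartialOrder; tri<; tri≈; tri>)
import Relation.Binary as Binary
open import Relation.Binary.PropositionalEquality
open import Data.Rational.Solver using (module +-*-Solver)
open import Algebra.Properties.CommutativeSemigroup ℕₚ.⊔-commutativeSemigroup using (x∙yz≈y∙xz)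

open import Defs

private variable
  A A′ B C : Set
  k m n : ℕ

maxℕ : List ℕ → ℕ
maxℕ = foldr _⊔_ 0

maxℕ-++ : ∀ xs ys → maxℕ (xs ++ ys) ≡ maxℕ xs ⊔ maxℕ ys
maxℕ-++ []       ys = refl
maxℕ-++ (x ∷ xs) ys = trans (cong (x ⊔_) (maxℕ-++ xs ys)) (sym (ℕₚ.⊔-assoc x (maxℕ xs) (maxℕ ys)))

maxℕ-least : ∀ {xs} → All (_≤ k) xs → maxℕ xs ≤ k
maxℕ-least []         = z≤n
maxℕ-least (x≤ ∷ xs≤) = ℕₚ.⊔-lub x≤ (maxℕ-least xs≤)

∈⇒≤maxℕ : ∀ {x xs} → x ∈ xs → x ≤ maxℕ xs
∈⇒≤maxℕ {xs = y ∷ ys} (here refl) = ℕₚ.m≤m⊔n y (maxℕ ys)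
∈⇒≤maxℕ {xs = y ∷ ys} (there x∈) = ℕₚ.≤-trans (∈⇒≤maxℕ x∈) (ℕₚ.m≤n⊔m y (maxℕ ys))

-- Shifting all entries up by m shifts the maximum by m; the extra m ⊔ makes this hold for
-- the empty list too, whose maximum is 0.
maxℕ-shift : ∀ m ys → m ⊔ maxℕ (map (m +_) ys) ≡ m + maxℕ ys
maxℕ-shift m []       = trans (ℕₚ.⊔-identityʳ m) (sym (ℕₚ.+-identityʳ m))
maxℕ-shift m (y ∷ ys) = begin
  m ⊔ ((m + y) ⊔ maxℕ (map (m +_) ys)) ≡⟨ x∙yz≈y∙xz m (m + y) _ ⟩
  (m + y) ⊔ (m ⊔ maxℕ (map (m +_) ys)) ≡⟨ cong ((m + y) ⊔_) (maxℕ-shift m ys) ⟩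
  (m + y) ⊔ (m + maxℕ ys)              ≡⟨ ℕₚ.+-distribˡ-⊔ m y (maxℕ ys) ⟨
  m + (y ⊔ maxℕ ys)                    ∎
  where open ≡-Reasoning

-- A minimum of differences x ∸ y is x minus the maximum of the subtrahends;
-- this is the fold by which Defs computes d.
foldr-∸⊓ : ∀ x (f : A → ℕ) e ys →
  foldr (λ j acc → (x ∸ f j) ⊓ acc) (x ∸ e) ys ≡ x ∸ (e ⊔ maxℕ (map f ys))
foldr-∸⊓ x f e []       = cong (x ∸_) (sym (ℕₚ.⊔-identityʳ e))
foldr-∸⊓ x f e (y ∷ ys) = begin
  (x ∸ f y) ⊓ foldr (λ j acc → (x ∸ f j) ⊓ acc) (x ∸ e) ys ≡⟨ cong ((x ∸ f y) ⊓_) (foldr-∸⊓ x f e ys) ⟩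
  (x ∸ f y) ⊓ (x ∸ (e ⊔ M))                                ≡⟨ ℕₚ.∸-distribˡ-⊔-⊓ x (f y) (e ⊔ M) ⟨
  x ∸ (f y ⊔ (e ⊔ M))                                      ≡⟨ cong (x ∸_) (x∙yz≈y∙xz (f y) e M) ⟩
  x ∸ (e ⊔ (f y ⊔ M))                                      ∎
  where
  open ≡-Reasoning
  M = maxℕ (map f ys)

d-as-max : (R : DecRel k) (σ : Fin k → Fin k) (i : Fin k) →
  d R σ i ≡ val σ i ∸ maxℕ (map (val σ) (preds R i))
d-as-max R σ i with preds R i
... | []     = refl
... | j ∷ js = foldr-∸⊓ (val σ i) (val σ) (val σ j) js

weight : (R : DecRel k) → (Fin k → Fin k) → ℚ
weight {k} R σ = sumℚ (map (λ i → H (d R σ i ∸ 1)) (allFin k))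

sumℚ-++ : ∀ xs ys → sumℚ (xs ++ ys) ≡ sumℚ xs +ℚ sumℚ ys
sumℚ-++ []       ys = sym (ℚₚ.+-identityˡ (sumℚ ys))
sumℚ-++ (x ∷ xs) ys = trans (cong (x +ℚ_) (sumℚ-++ xs ys)) (sym (ℚₚ.+-assoc x (sumℚ xs) (sumℚ ys)))

sumℚ-↭ : ∀ {xs ys} → xs ↭ ys → sumℚ xs ≡ sumℚ ys
sumℚ-↭ p = foldr-commMonoid (setoid ℚ) ℚₚ.+-0-isCommutativeMonoid (↭⇒↭ₛ p)

mean : ℕ → ℚ → ℚ
mean zero    s = 0ℚ
mean (suc k) s = s *ℚ (ℤ.+ 1 / suc k)

avg-mean : ∀ xs → avg xs ≡ mean (length xs) (sumℚ xs)
avg-mean xs with length xs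
... | zero  = refl
... | suc k = refl

avg-↭ : ∀ {xs ys} → xs ↭ ys → avg xs ≡ avg ys
avg-↭ {xs} {ys} xs↭ys = begin
  avg xs                         ≡⟨ avg-mean xs ⟩
  mean (length xs) (sumℚ xs)     ≡⟨ cong₂ mean (Permₚ.↭-length xs↭ys) (sumℚ-↭ xs↭ys) ⟩
  mean (length ys) (sumℚ ys)     ≡⟨ avg-mean ys ⟨
  avg ys                         ∎
  where open ≡-Reasoning

avg-nonempty : ∀ xs {r} → length xs ≡ suc r → avg xs ≡ sumℚ xs *ℚ (ℤ.+ 1 / suc r)
avg-nonempty xs |xs| = trans (avg-mean xs) (cong (λ l → mean l (sumℚ xs)) |xs|)

ℕ→ℚ : ℕ → ℚ
ℕ→ℚ k = ℤ.+ k / 1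

-- Arithmetic on the fractions a/(b+1) is checked on their unnormalised representatives.
toℚᵘ-/ : ∀ a b → toℚᵘ (ℤ.+ a / suc b) ≃ᵘ mkℚᵘ (ℤ.+ a) b
toℚᵘ-/ a b = ℚₚ.toℚᵘ-fromℚᵘ (mkℚᵘ (ℤ.+ a) b)

ℕ→ℚ-suc : ∀ k → ℕ→ℚ (suc k) ≡ 1ℚ +ℚ ℕ→ℚ k
ℕ→ℚ-suc k = ℚₚ.toℚᵘ-injective (ℚᵘₚ.≃-trans (toℚᵘ-/ (suc k) 0) (ℚᵘₚ.≃-sym
  (ℚᵘₚ.≃-trans (ℚₚ.toℚᵘ-homo-+ 1ℚ (ℕ→ℚ k))
  (ℚᵘₚ.≃-trans (ℚᵘₚ.+-cong (toℚᵘ-/ 1 0) (toℚᵘ-/ k 0)) (*≡* numerators)))))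
  where
  numerators : (ℤ.+ 1 ℤ.+ ℤ.+ k ℤ.* ℤ.+ 1) ℤ.* ℤ.+ 1 ≡ ℤ.+ suc k ℤ.* ℤ.+ 1
  numerators = cong (λ z → (ℤ.+ 1 ℤ.+ z) ℤ.* ℤ.+ 1) (ℤₚ.*-identityʳ (ℤ.+ k))

ℕ→ℚ-recip : ∀ k → ℕ→ℚ (suc k) *ℚ (ℤ.+ 1 / suc k) ≡ 1ℚ
ℕ→ℚ-recip k = ℚₚ.toℚᵘ-injective (ℚᵘₚ.≃-trans (ℚₚ.toℚᵘ-homo-* (ℕ→ℚ (suc k)) (ℤ.+ 1 / suc k))
  (ℚᵘₚ.≃-trans (ℚᵘₚ.*-cong (toℚᵘ-/ (suc k) 0) (toℚᵘ-/ 1 k)) (*≡* cross)))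
  where
  cross : (ℤ.+ suc k ℤ.* ℤ.+ 1) ℤ.* ℤ.+ 1 ≡ ℤ.+ 1 ℤ.* (ℤ.+ 1 ℤ.* ℤ.+ suc k)
  cross = trans (ℤₚ.*-identityʳ (ℤ.+ suc k ℤ.* ℤ.+ 1)) (trans (ℤₚ.*-identityʳ (ℤ.+ suc k))
            (sym (trans (ℤₚ.*-identityˡ (ℤ.+ 1 ℤ.* ℤ.+ suc k)) (ℤₚ.*-identityˡ (ℤ.+ suc k)))))

recip-* : ∀ p q → ℤ.+ 1 / (suc p * suc q) ≡ (ℤ.+ 1 / suc p) *ℚ (ℤ.+ 1 / suc q)
recip-* p q = ℚₚ.toℚᵘ-injective (ℚᵘₚ.≃-trans (toℚᵘ-/ 1 _) (ℚᵘₚ.≃-sym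
  (ℚᵘₚ.≃-trans (ℚₚ.toℚᵘ-homo-* (ℤ.+ 1 / suc p) (ℤ.+ 1 / suc q))
               (ℚᵘₚ.*-cong (toℚᵘ-/ 1 p) (toℚᵘ-/ 1 q)))))

sum-shifted : ∀ c (g : A → ℚ) ys →
  sumℚ (map (λ y → c +ℚ g y) ys) ≡ c *ℚ ℕ→ℚ (length ys) +ℚ sumℚ (map g ys)
sum-shifted c g [] = sym (trans (cong (_+ℚ 0ℚ) (ℚₚ.*-zeroʳ c)) (ℚₚ.+-identityʳ 0ℚ))
sum-shifted c g (y ∷ ys) = begin
  (c +ℚ g y) +ℚ sumℚ (map (λ y → c +ℚ g y) ys)      ≡⟨ cong ((c +ℚ g y) +ℚ_) (sum-shifted c g ys) ⟩
  (c +ℚ g y) +ℚ (c *ℚ ℕ→ℚ (length ys) +ℚ S)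
    ≡⟨ solve 4 (λ c gy l S → (c :+ gy) :+ (c :* l :+ S) := c :* (con 1ℚ :+ l) :+ (gy :+ S))
             refl c (g y) (ℕ→ℚ (length ys)) S ⟩
  c *ℚ (1ℚ +ℚ ℕ→ℚ (length ys)) +ℚ (g y +ℚ S)
    ≡⟨ cong (λ l → c *ℚ l +ℚ (g y +ℚ S)) (ℕ→ℚ-suc (length ys)) ⟨
  c *ℚ ℕ→ℚ (suc (length ys)) +ℚ (g y +ℚ S)           ∎
  where
  open ≡-Reasoning
  open +-*-Solver
  S = sumℚ (map g ys)

length-cartesianProductWith : ∀ (f : A → B → C) xs ys →
  length (cartesianProductWith f xs ys) ≡ length xs * length ys
length-cartesianProductWith f []       ys = refl
length-cartesianProductWith f (x ∷ xs) ys = begin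
  length (map (f x) ys ++ cartesianProductWith f xs ys)   ≡⟨ Listₚ.length-++ (map (f x) ys) ⟩
  length (map (f x) ys) + length (cartesianProductWith f xs ys)
    ≡⟨ cong₂ _+_ (Listₚ.length-map (f x) ys) (length-cartesianProductWith f xs ys) ⟩
  length ys + length xs * length ys                       ∎
  where open ≡-Reasoning

sum-cartesian : ∀ (f : A → ℚ) (g : B → ℚ) xs ys →
  sumℚ (cartesianProductWith (λ x y → f x +ℚ g y) xs ys)
    ≡ sumℚ (map f xs) *ℚ ℕ→ℚ (length ys) +ℚ ℕ→ℚ (length xs) *ℚ sumℚ (map g ys)
sum-cartesian f g [] ys =
  solve 2 (λ l S → con 0ℚ := con 0ℚ :* l :+ con 0ℚ :* S) refl (ℕ→ℚ (length ys)) (sumℚ (map g ys))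
  where open +-*-Solver
sum-cartesian f g (x ∷ xs) ys = begin
  sumℚ (map (λ y → f x +ℚ g y) ys ++ cartesianProductWith (λ x y → f x +ℚ g y) xs ys)
    ≡⟨ sumℚ-++ (map (λ y → f x +ℚ g y) ys) _ ⟩
  sumℚ (map (λ y → f x +ℚ g y) ys) +ℚ sumℚ (cartesianProductWith (λ x y → f x +ℚ g y) xs ys)
    ≡⟨ cong₂ _+ℚ_ (sum-shifted (f x) g ys) (sum-cartesian f g xs ys) ⟩
  (f x *ℚ L +ℚ T) +ℚ (S *ℚ L +ℚ ℕ→ℚ (length xs) *ℚ T)
    ≡⟨ solve 5 (λ fx L T S N → (fx :* L :+ T) :+ (S :* L :+ N :* T) := (fx :+ S) :* L :+ (con 1ℚ :+ N) :* T)
             refl (f x) L T S (ℕ→ℚ (length xs)) ⟩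
  (f x +ℚ S) *ℚ L +ℚ (1ℚ +ℚ ℕ→ℚ (length xs)) *ℚ T
    ≡⟨ cong (λ N → (f x +ℚ S) *ℚ L +ℚ N *ℚ T) (ℕ→ℚ-suc (length xs)) ⟨
  (f x +ℚ S) *ℚ L +ℚ ℕ→ℚ (suc (length xs)) *ℚ T ∎
  where
  open ≡-Reasoning
  open +-*-Solver
  L = ℕ→ℚ (length ys)
  S = sumℚ (map f xs)
  T = sumℚ (map g ys)

avg-cartesian : ∀ (f : A → ℚ) (g : B → ℚ) xs ys {p q} → length xs ≡ suc p → length ys ≡ suc q →
  avg (cartesianProductWith (λ x y → f x +ℚ g y) xs ys) ≡ avg (map f xs) +ℚ avg (map g ys)
avg-cartesian f g xs ys {p} {q} |xs| |ys| = begin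
  avg L                                                         ≡⟨ avg-mean L ⟩
  mean (length L) (sumℚ L)                                      ≡⟨ cong₂ mean length-L sum-L ⟩
  (S *ℚ ℕ→ℚ (suc q) +ℚ ℕ→ℚ (suc p) *ℚ T) *ℚ (ℤ.+ 1 / (suc p * suc q))
    ≡⟨ cong ((S *ℚ ℕ→ℚ (suc q) +ℚ ℕ→ℚ (suc p) *ℚ T) *ℚ_) (recip-* p q) ⟩
  (S *ℚ ℕ→ℚ (suc q) +ℚ ℕ→ℚ (suc p) *ℚ T) *ℚ (u *ℚ v)
    ≡⟨ solve 6 (λ S T u v P Q → (S :* Q :+ P :* T) :* (u :* v) := S :* u :* (Q :* v) :+ T :* v :* (P :* u))
             refl S T u v (ℕ→ℚ (suc p)) (ℕ→ℚ (suc q)) ⟩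
  S *ℚ u *ℚ (ℕ→ℚ (suc q) *ℚ v) +ℚ T *ℚ v *ℚ (ℕ→ℚ (suc p) *ℚ u)
    ≡⟨ cong₂ (λ a b → S *ℚ u *ℚ a +ℚ T *ℚ v *ℚ b) (ℕ→ℚ-recip q) (ℕ→ℚ-recip p) ⟩
  S *ℚ u *ℚ 1ℚ +ℚ T *ℚ v *ℚ 1ℚ
    ≡⟨ cong₂ _+ℚ_ (ℚₚ.*-identityʳ (S *ℚ u)) (ℚₚ.*-identityʳ (T *ℚ v)) ⟩
  S *ℚ u +ℚ T *ℚ v
    ≡⟨ cong₂ _+ℚ_ (avg-nonempty (map f xs) (trans (Listₚ.length-map f xs) |xs|))
                  (avg-nonempty (map g ys) (trans (Listₚ.length-map g ys) |ys|)) ⟨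
  avg (map f xs) +ℚ avg (map g ys)                              ∎
  where
  open ≡-Reasoning
  open +-*-Solver
  L = cartesianProductWith (λ x y → f x +ℚ g y) xs ys
  S = sumℚ (map f xs)
  T = sumℚ (map g ys)
  u = ℤ.+ 1 / suc p
  v = ℤ.+ 1 / suc q
  length-L : length L ≡ suc p * suc q
  length-L = trans (length-cartesianProductWith _ xs ys) (cong₂ _*_ |xs| |ys|)
  sum-L : sumℚ L ≡ S *ℚ ℕ→ℚ (suc q) +ℚ ℕ→ℚ (suc p) *ℚ T
  sum-L = trans (sum-cartesian f g xs ys) (cong₂ (λ a b → S *ℚ ℕ→ℚ a +ℚ ℕ→ℚ b *ℚ T) |ys| |xs|)

filter-map : ∀ {P : Pred B 0ℓ} (P? : Decidable P) (g : A → B) xs →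
  filter P? (map g xs) ≡ map g (filter (P? ∘ g) xs)
filter-map P? g []       = refl
filter-map P? g (x ∷ xs) with P? (g x)
... | yes _ = cong (g x ∷_) (filter-map P? g xs)
... | no  _ = filter-map P? g xs

map-cartesianProductWith : ∀ (h : C → A) (f : A′ → B → C) (g : A′ → B → A) xs ys →
  (∀ {x} → x ∈ xs → ∀ y → h (f x y) ≡ g x y) →
  map h (cartesianProductWith f xs ys) ≡ cartesianProductWith g xs ys
map-cartesianProductWith h f g []       ys hfg = refl
map-cartesianProductWith h f g (x ∷ xs) ys hfg = begin
  map h (map (f x) ys ++ cartesianProductWith f xs ys)          ≡⟨ Listₚ.map-++ h (map (f x) ys) _ ⟩
  map h (map (f x) ys) ++ map h (cartesianProductWith f xs ys)
    ≡⟨ cong₂ _++_ (trans (sym (Listₚ.map-∘ ys)) (Listₚ.map-cong (hfg (here refl)) ys))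
                  (map-cartesianProductWith h f g xs ys (hfg ∘ there)) ⟩
  map (g x) ys ++ cartesianProductWith g xs ys                  ∎
  where open ≡-Reasoning

allFin-split : ∀ m n → allFin (m + n) ≡ map (_↑ˡ n) (allFin m) ++ map (m ↑ʳ_) (allFin n)
allFin-split m n = trans (tabulate-split m id)
  (sym (cong₂ _++_ (Listₚ.map-tabulate id (_↑ˡ n)) (Listₚ.map-tabulate id (m ↑ʳ_))))
  where
  tabulate-split : ∀ m {n} (f : Fin (m + n) → A) →
    tabulate f ≡ tabulate (f ∘ (_↑ˡ n)) ++ tabulate (f ∘ (m ↑ʳ_))
  tabulate-split zero    f = refl
  tabulate-split (suc m) f = cong (f Fin.zero ∷_) (tabulate-split m (f ∘ Fin.suc))

filter-allFin-split : ∀ m n {P : Pred (Fin (m + n)) 0ℓ} (P? : Decidable P) →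
  filter P? (allFin (m + n))
    ≡ map (_↑ˡ n) (filter (P? ∘ (_↑ˡ n)) (allFin m)) ++ map (m ↑ʳ_) (filter (P? ∘ (m ↑ʳ_)) (allFin n))
filter-allFin-split m n P? = begin
  filter P? (allFin (m + n))                                                 ≡⟨ cong (filter P?) (allFin-split m n) ⟩
  filter P? (map (_↑ˡ n) (allFin m) ++ map (m ↑ʳ_) (allFin n))
    ≡⟨ Listₚ.filter-++ P? (map (_↑ˡ n) (allFin m)) _ ⟩
  filter P? (map (_↑ˡ n) (allFin m)) ++ filter P? (map (m ↑ʳ_) (allFin n))
    ≡⟨ cong₂ _++_ (filter-map P? (_↑ˡ n) (allFin m)) (filter-map P? (m ↑ʳ_) (allFin n)) ⟩
  map (_↑ˡ n) (filter (P? ∘ (_↑ˡ n)) (allFin m)) ++ map (m ↑ʳ_) (filter (P? ∘ (m ↑ʳ_)) (allFin n)) ∎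
  where open ≡-Reasoning

sumℚ-allFin-split : ∀ m n (f : Fin (m + n) → ℚ) →
  sumℚ (map f (allFin (m + n))) ≡ sumℚ (map (f ∘ (_↑ˡ n)) (allFin m)) +ℚ sumℚ (map (f ∘ (m ↑ʳ_)) (allFin n))
sumℚ-allFin-split m n f = begin
  sumℚ (map f (allFin (m + n)))                                              ≡⟨ cong (sumℚ ∘ map f) (allFin-split m n) ⟩
  sumℚ (map f (map (_↑ˡ n) (allFin m) ++ map (m ↑ʳ_) (allFin n)))
    ≡⟨ cong sumℚ (Listₚ.map-++ f (map (_↑ˡ n) (allFin m)) _) ⟩
  sumℚ (map f (map (_↑ˡ n) (allFin m)) ++ map f (map (m ↑ʳ_) (allFin n)))
    ≡⟨ sumℚ-++ (map f (map (_↑ˡ n) (allFin m))) _ ⟩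
  sumℚ (map f (map (_↑ˡ n) (allFin m))) +ℚ sumℚ (map f (map (m ↑ʳ_) (allFin n)))
    ≡⟨ cong₂ (λ l r → sumℚ l +ℚ sumℚ r) (Listₚ.map-∘ (allFin m)) (Listₚ.map-∘ (allFin n)) ⟨
  sumℚ (map (f ∘ (_↑ˡ n)) (allFin m)) +ℚ sumℚ (map (f ∘ (m ↑ʳ_)) (allFin n)) ∎
  where open ≡-Reasoning

data Side (m n : ℕ) : Fin (m + n) → Set where
  left  : (a : Fin m) → Side m n (a ↑ˡ n)
  right : (b : Fin n) → Side m n (m ↑ʳ b)

side : ∀ m n (i : Fin (m + n)) → Side m n i
side m n i with splitAt m i in eq
... | inj₁ a = subst (Side m n) (Finₚ.splitAt⁻¹-↑ˡ eq) (left a)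
... | inj₂ b = subst (Side m n) (Finₚ.splitAt⁻¹-↑ʳ eq) (right b)

toℕ-left<m : (a : Fin m) → toℕ (a ↑ˡ n) < m
toℕ-left<m {n = n} a = subst (_< _) (sym (Finₚ.toℕ-↑ˡ a n)) (Finₚ.toℕ<n a)

m≤toℕ-right : (b : Fin n) → m ≤ toℕ (m ↑ʳ b)
m≤toℕ-right {m = m} b = subst (m ≤_) (sym (Finₚ.toℕ-↑ʳ m b)) (ℕₚ.m≤m+n m (toℕ b))

↑ˡ≢↑ʳ : (a : Fin m) (b : Fin n) → a ↑ˡ n ≢ m ↑ʳ b
↑ˡ≢↑ʳ a b eq = ℕₚ.<⇒≱ (toℕ-left<m a) (subst (λ i → _ ≤ toℕ i) (sym eq) (m≤toℕ-right b))

left-of : (i : Fin (m + n)) → toℕ i < m → ∃ λ a → a ↑ˡ n ≡ i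
left-of {m = m} {n} i i<m with side m n i
... | left a  = a , refl
... | right b = ⊥-elim (ℕₚ.<⇒≱ i<m (m≤toℕ-right b))

right-of : (i : Fin (m + n)) → m ≤ toℕ i → ∃ λ b → m ↑ʳ b ≡ i
right-of {m = m} {n} i m≤i with side m n i
... | left a  = ⊥-elim (ℕₚ.<⇒≱ (toℕ-left<m a) m≤i)
... | right b = b , refl

injection-above : (g : Fin k → Fin (m + n)) → (∀ i j → g i ≡ g j → i ≡ j) →
  (∀ i → m ≤ toℕ (g i)) → k ≤ n
injection-above {m = m} g g-inj above = Finₚ.injective⇒≤ (λ {i} {j} eq → g-inj i j
  (trans (sym (proj₂ (part i))) (trans (cong (m ↑ʳ_) eq) (proj₂ (part j)))))
  where part = λ i → right-of (g i) (above i)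

injection-below : (g : Fin k → Fin (m + n)) → (∀ i j → g i ≡ g j → i ≡ j) →
  (∀ i → toℕ (g i) < m) → k ≤ m
injection-below {n = n} g g-inj below = Finₚ.injective⇒≤ (λ {i} {j} eq → g-inj i j
  (trans (sym (proj₂ (part i))) (trans (cong (_↑ˡ n) eq) (proj₂ (part j)))))
  where part = λ i → left-of (g i) (below i)

module _ (P : DecRel m) (Q : DecRel n) where

  ⊕-left : (a a′ : Fin m) → _≤ᴿ_ (P ⊕ Q) (a ↑ˡ n) (a′ ↑ˡ n) ⇔ _≤ᴿ_ P a a′
  ⊕-left a a′ rewrite Finₚ.splitAt-↑ˡ m a n | Finₚ.splitAt-↑ˡ m a′ n = mk⇔ id id

  ⊕-right : (b b′ : Fin n) → _≤ᴿ_ (P ⊕ Q) (m ↑ʳ b) (m ↑ʳ b′) ⇔ _≤ᴿ_ Q b b′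
  ⊕-right b b′ rewrite Finₚ.splitAt-↑ʳ m n b | Finₚ.splitAt-↑ʳ m n b′ = mk⇔ id id

  ⊕-across : (a : Fin m) (b : Fin n) → _≤ᴿ_ (P ⊕ Q) (a ↑ˡ n) (m ↑ʳ b)
  ⊕-across a b rewrite Finₚ.splitAt-↑ˡ m a n | Finₚ.splitAt-↑ʳ m n b = tt

  ⊕-not-back : (b : Fin n) (a : Fin m) → ¬ _≤ᴿ_ (P ⊕ Q) (m ↑ʳ b) (a ↑ˡ n)
  ⊕-not-back b a rewrite Finₚ.splitAt-↑ˡ m a n | Finₚ.splitAt-↑ʳ m n b = λ ()

  preds-left : (a : Fin m) → preds (P ⊕ Q) (a ↑ˡ n) ≡ map (_↑ˡ n) (preds P a)
  preds-left a = begin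
    preds (P ⊕ Q) (a ↑ˡ n)                                    ≡⟨ filter-allFin-split m n pred? ⟩
    map (_↑ˡ n) (filter (pred? ∘ (_↑ˡ n)) (allFin m)) ++ map (m ↑ʳ_) (filter (pred? ∘ (m ↑ʳ_)) (allFin n))
      ≡⟨ cong₂ (λ l r → map (_↑ˡ n) l ++ map (m ↑ʳ_) r)
               (Listₚ.filter-≐ (pred? ∘ (_↑ˡ n)) (λ j → ¬? (j Finₚ.≟ a) ×-dec _≤?_ P j a) same (allFin m))
               (Listₚ.filter-none (pred? ∘ (m ↑ʳ_)) (All.universal (λ b → ⊕-not-back b a ∘ proj₂) (allFin n))) ⟩
    map (_↑ˡ n) (preds P a) ++ []                             ≡⟨ Listₚ.++-identityʳ _ ⟩
    map (_↑ˡ n) (preds P a)                                   ∎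
    where
    open ≡-Reasoning
    pred? = λ j → ¬? (j Finₚ.≟ (a ↑ˡ n)) ×-dec _≤?_ (P ⊕ Q) j (a ↑ˡ n)
    same = (λ {j} (j≢a , j≤a) → j≢a ∘ cong (_↑ˡ n) , Equivalence.to (⊕-left j a) j≤a)
         , (λ {j} (j≢a , j≤a) → j≢a ∘ Finₚ.↑ˡ-injective n j a , Equivalence.from (⊕-left j a) j≤a)

  preds-right : (b : Fin n) → preds (P ⊕ Q) (m ↑ʳ b) ≡ map (_↑ˡ n) (allFin m) ++ map (m ↑ʳ_) (preds Q b)
  preds-right b = begin
    preds (P ⊕ Q) (m ↑ʳ b)                                    ≡⟨ filter-allFin-split m n pred? ⟩
    map (_↑ˡ n) (filter (pred? ∘ (_↑ˡ n)) (allFin m)) ++ map (m ↑ʳ_) (filter (pred? ∘ (m ↑ʳ_)) (allFin n))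
      ≡⟨ cong₂ (λ l r → map (_↑ˡ n) l ++ map (m ↑ʳ_) r)
               (Listₚ.filter-all (pred? ∘ (_↑ˡ n)) (All.universal (λ a → ↑ˡ≢↑ʳ a b , ⊕-across a b) (allFin m)))
               (Listₚ.filter-≐ (pred? ∘ (m ↑ʳ_)) (λ j → ¬? (j Finₚ.≟ b) ×-dec _≤?_ Q j b) same (allFin n)) ⟩
    map (_↑ˡ n) (allFin m) ++ map (m ↑ʳ_) (preds Q b)         ∎
    where
    open ≡-Reasoning
    pred? = λ j → ¬? (j Finₚ.≟ (m ↑ʳ b)) ×-dec _≤?_ (P ⊕ Q) j (m ↑ʳ b)
    same = (λ {j} (j≢b , j≤b) → j≢b ∘ cong (m ↑ʳ_) , Equivalence.to (⊕-right j b) j≤b)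
         , (λ {j} (j≢b , j≤b) → j≢b ∘ Finₚ.↑ʳ-injective m j b , Equivalence.from (⊕-right j b) j≤b)

-- stack s t orders P ⊕ Q by s on the first m positions and by t, shifted by m, on the
-- remaining n; it is the general shape of a linear extension of P ⊕ Q.
stack : (Fin m → Fin m) → (Fin n → Fin n) → Fin (m + n) → Fin (m + n)
stack {m} {n} s t i = join m n (Sum.map s t (splitAt m i))

-- The values val s a = 1 + s a of an onto map s of Fin m are at most m and include m,
-- so their maximum is m.
maxℕ-values : (s : Fin m → Fin m) → (∀ c → ∃ λ a → s a ≡ c) → maxℕ (map (val s) (allFin m)) ≡ m
maxℕ-values {zero}  s s-onto = refl
maxℕ-values {suc m} s s-onto = ℕₚ.≤-antisym
  (maxℕ-least (Allₚ.map⁺ (All.universal (λ a → Finₚ.toℕ<n (s a)) (allFin (suc m)))))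
  (subst (_≤ maxℕ (map (val s) (allFin (suc m)))) top-value (∈⇒≤maxℕ (∈-map⁺ (val s) (∈-allFin top))))
  where
  top = proj₁ (s-onto (Fin.fromℕ m))
  top-value : val s top ≡ suc m
  top-value = cong suc (trans (cong toℕ (proj₂ (s-onto (Fin.fromℕ m)))) (Finₚ.toℕ-fromℕ m))

module _ {s : Fin m → Fin m} {t : Fin n → Fin n} where

  stack-left : (a : Fin m) → stack s t (a ↑ˡ n) ≡ s a ↑ˡ n
  stack-left a rewrite Finₚ.splitAt-↑ˡ m a n = refl

  stack-right : (b : Fin n) → stack s t (m ↑ʳ b) ≡ m ↑ʳ t b
  stack-right b rewrite Finₚ.splitAt-↑ʳ m n b = refl

  val-left : (a : Fin m) → val (stack s t) (a ↑ˡ n) ≡ val s a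
  val-left a = cong suc (trans (cong toℕ (stack-left a)) (Finₚ.toℕ-↑ˡ (s a) n))

  val-right : (b : Fin n) → val (stack s t) (m ↑ʳ b) ≡ m + val t b
  val-right b = trans (cong suc (trans (cong toℕ (stack-right b)) (Finₚ.toℕ-↑ʳ m (t b))))
                      (sym (ℕₚ.+-suc m (toℕ (t b))))

stack-cong : ∀ {s s′ : Fin m → Fin m} {t t′ : Fin n → Fin n} →
  (∀ a → s a ≡ s′ a) → (∀ b → t b ≡ t′ b) → ∀ i → stack s t i ≡ stack s′ t′ i
stack-cong {m} {n} s≗s′ t≗t′ i with splitAt m i
... | inj₁ a = cong (_↑ˡ n) (s≗s′ a)
... | inj₂ b = cong (m ↑ʳ_) (t≗t′ b)

module _ {P : DecRel m} {Q : DecRel n} {s : Fin m → Fin m} {t : Fin n → Fin n} where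

  private σ = stack s t

  d-stack-left : (a : Fin m) → d (P ⊕ Q) (stack s t) (a ↑ˡ n) ≡ d P s a
  d-stack-left a = begin
    d (P ⊕ Q) σ (a ↑ˡ n)                                       ≡⟨ d-as-max (P ⊕ Q) σ (a ↑ˡ n) ⟩
    val σ (a ↑ˡ n) ∸ maxℕ (map (val σ) (preds (P ⊕ Q) (a ↑ˡ n)))
      ≡⟨ cong₂ (λ x vs → x ∸ maxℕ vs) (val-left a) values ⟩
    val s a ∸ maxℕ (map (val s) (preds P a))                    ≡⟨ d-as-max P s a ⟨
    d P s a                                                     ∎
    where
    open ≡-Reasoning
    values : map (val σ) (preds (P ⊕ Q) (a ↑ˡ n)) ≡ map (val s) (preds P a)
    values = trans (cong (map (val σ)) (preds-left P Q a))
                   (trans (sym (Listₚ.map-∘ (preds P a))) (Listₚ.map-cong val-left (preds P a)))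

  -- Elements of Q keep their d-values too: all of P lies below them, and the largest value
  -- of a P-element is m, which cancels against the shift by m.
  d-stack-right : (∀ c → ∃ λ a → s a ≡ c) → (b : Fin n) → d (P ⊕ Q) (stack s t) (m ↑ʳ b) ≡ d Q t b
  d-stack-right s-onto b = begin
    d (P ⊕ Q) σ (m ↑ʳ b)                                       ≡⟨ d-as-max (P ⊕ Q) σ (m ↑ʳ b) ⟩
    val σ (m ↑ʳ b) ∸ maxℕ (map (val σ) (preds (P ⊕ Q) (m ↑ʳ b)))
      ≡⟨ cong₂ (λ x vs → x ∸ maxℕ vs) (val-right b) values ⟩
    (m + val t b) ∸ maxℕ (map (val s) (allFin m) ++ map (m +_) M) ≡⟨ cong ((m + val t b) ∸_) maximum ⟩
    (m + val t b) ∸ (m + maxℕ M)                                ≡⟨ ℕₚ.[m+n]∸[m+o]≡n∸o m (val t b) (maxℕ M) ⟩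
    val t b ∸ maxℕ M                                            ≡⟨ d-as-max Q t b ⟨
    d Q t b                                                     ∎
    where
    open ≡-Reasoning
    M = map (val t) (preds Q b)
    values : map (val σ) (preds (P ⊕ Q) (m ↑ʳ b)) ≡ map (val s) (allFin m) ++ map (m +_) M
    values = begin
      map (val σ) (preds (P ⊕ Q) (m ↑ʳ b))                      ≡⟨ cong (map (val σ)) (preds-right P Q b) ⟩
      map (val σ) (map (_↑ˡ n) (allFin m) ++ map (m ↑ʳ_) (preds Q b))
        ≡⟨ Listₚ.map-++ (val σ) (map (_↑ˡ n) (allFin m)) _ ⟩
      map (val σ) (map (_↑ˡ n) (allFin m)) ++ map (val σ) (map (m ↑ʳ_) (preds Q b))
        ≡⟨ cong₂ _++_ (trans (sym (Listₚ.map-∘ (allFin m))) (Listₚ.map-cong val-left (allFin m)))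
                      (trans (sym (Listₚ.map-∘ (preds Q b)))
                             (trans (Listₚ.map-cong val-right (preds Q b)) (Listₚ.map-∘ (preds Q b)))) ⟩
      map (val s) (allFin m) ++ map (m +_) M                     ∎
    maximum : maxℕ (map (val s) (allFin m) ++ map (m +_) M) ≡ m + maxℕ M
    maximum = trans (maxℕ-++ (map (val s) (allFin m)) _)
                    (trans (cong (_⊔ maxℕ (map (m +_) M)) (maxℕ-values s s-onto)) (maxℕ-shift m M))

  weight-stack : (∀ c → ∃ λ a → s a ≡ c) → weight (P ⊕ Q) (stack s t) ≡ weight P s +ℚ weight Q t
  weight-stack s-onto = trans (sumℚ-allFin-split m n (λ i → H (d (P ⊕ Q) σ i ∸ 1)))
    (cong₂ _+ℚ_ (cong sumℚ (Listₚ.map-cong (λ a → cong (λ x → H (x ∸ 1)) (d-stack-left a)) (allFin m)))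
                (cong sumℚ (Listₚ.map-cong (λ b → cong (λ x → H (x ∸ 1)) (d-stack-right s-onto b)) (allFin n))))

  stack-linExt : IsLinExt P s → IsLinExt Q t → IsLinExt (P ⊕ Q) (stack s t)
  stack-linExt (s-inj , s-onto , s-mono) (t-inj , t-onto , t-mono) = inj , onto , mono
    where
    inj : ∀ i j → σ i ≡ σ j → i ≡ j
    inj i j eq with side m n i | side m n j
    ... | left a  | left a′  = cong (_↑ˡ n) (s-inj a a′
      (Finₚ.↑ˡ-injective n _ _ (trans (sym (stack-left a)) (trans eq (stack-left a′)))))
    ... | left a  | right b  = ⊥-elim (↑ˡ≢↑ʳ (s a) (t b) (trans (sym (stack-left a)) (trans eq (stack-right b))))
    ... | right b | left a   = ⊥-elim (↑ˡ≢↑ʳ (s a) (t b) (trans (sym (stack-left a)) (trans (sym eq) (stack-right b))))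
    ... | right b | right b′ = cong (m ↑ʳ_) (t-inj b b′
      (Finₚ.↑ʳ-injective m _ _ (trans (sym (stack-right b)) (trans eq (stack-right b′)))))
    onto : ∀ c → ∃ λ i → σ i ≡ c
    onto c with side m n c
    ... | left c′  = let (a , sa≡c′) = s-onto c′ in a ↑ˡ n , trans (stack-left a) (cong (_↑ˡ n) sa≡c′)
    ... | right c′ = let (b , tb≡c′) = t-onto c′ in m ↑ʳ b , trans (stack-right b) (cong (m ↑ʳ_) tb≡c′)
    mono : ∀ i j → _≤ᴿ_ (P ⊕ Q) i j → val σ i ≤ val σ j
    mono i j i≤j with side m n i | side m n j
    ... | left a  | left a′  = subst₂ _≤_ (sym (val-left a)) (sym (val-left a′))
      (s-mono a a′ (Equivalence.to (⊕-left P Q a a′) i≤j))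
    ... | left a  | right b  = subst₂ _≤_ (sym (val-left a)) (sym (val-right b))
      (ℕₚ.≤-trans (Finₚ.toℕ<n (s a)) (ℕₚ.m≤m+n m (val t b)))
    ... | right b | left a   = ⊥-elim (⊕-not-back P Q b a i≤j)
    ... | right b | right b′ = subst₂ _≤_ (sym (val-right b)) (sym (val-right b′))
      (ℕₚ.+-monoʳ-≤ m (t-mono b b′ (Equivalence.to (⊕-right P Q b b′) i≤j)))

  unstack-linExt : IsLinExt (P ⊕ Q) (stack s t) → IsLinExt P s × IsLinExt Q t
  unstack-linExt (σ-inj , σ-onto , σ-mono) = (s-inj , s-onto , s-mono) , (t-inj , t-onto , t-mono)
    where
    s-inj : ∀ a a′ → s a ≡ s a′ → a ≡ a′
    s-inj a a′ eq = Finₚ.↑ˡ-injective n a a′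
      (σ-inj _ _ (trans (stack-left a) (trans (cong (_↑ˡ n) eq) (sym (stack-left a′)))))
    t-inj : ∀ b b′ → t b ≡ t b′ → b ≡ b′
    t-inj b b′ eq = Finₚ.↑ʳ-injective m b b′
      (σ-inj _ _ (trans (stack-right b) (trans (cong (m ↑ʳ_) eq) (sym (stack-right b′)))))
    s-onto : ∀ c → ∃ λ a → s a ≡ c
    s-onto c with σ-onto (c ↑ˡ n)
    ... | i , σi≡c with side m n i
    ...   | left a  = a , Finₚ.↑ˡ-injective n (s a) c (trans (sym (stack-left a)) σi≡c)
    ...   | right b = ⊥-elim (↑ˡ≢↑ʳ c (t b) (trans (sym σi≡c) (stack-right b)))
    t-onto : ∀ c → ∃ λ b → t b ≡ c
    t-onto c with σ-onto (m ↑ʳ c)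
    ... | i , σi≡c with side m n i
    ...   | left a  = ⊥-elim (↑ˡ≢↑ʳ (s a) c (trans (sym (stack-left a)) σi≡c))
    ...   | right b = b , Finₚ.↑ʳ-injective m (t b) c (trans (sym (stack-right b)) σi≡c)
    s-mono : ∀ a a′ → _≤ᴿ_ P a a′ → val s a ≤ val s a′
    s-mono a a′ a≤a′ = subst₂ _≤_ (val-left a) (val-left a′)
      (σ-mono _ _ (Equivalence.from (⊕-left P Q a a′) a≤a′))
    t-mono : ∀ b b′ → _≤ᴿ_ Q b b′ → val t b ≤ val t b′
    t-mono b b′ b≤b′ = ℕₚ.+-cancelˡ-≤ m _ _ (subst₂ _≤_ (val-right b) (val-right b′)
      (σ-mono _ _ (Equivalence.from (⊕-right P Q b b′) b≤b′)))

∷-injective : ∀ {x : A} {f : Fin k → A} → (∀ i → f i ≢ x) → (∀ i j → f i ≡ f j → i ≡ j) →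
  ∀ i j → (x VecF.∷ f) i ≡ (x VecF.∷ f) j → i ≡ j
∷-injective fresh f-inj Fin.zero    Fin.zero    _  = refl
∷-injective fresh f-inj Fin.zero    (Fin.suc j) eq = ⊥-elim (fresh j (sym eq))
∷-injective fresh f-inj (Fin.suc i) Fin.zero    eq = ⊥-elim (fresh i eq)
∷-injective fresh f-inj (Fin.suc i) (Fin.suc j) eq = cong Fin.suc (f-inj i j eq)

module _ (P : DecRel m) (Q : DecRel n) {σ : Fin (m + n) → Fin (m + n)} (σ-linExt : IsLinExt (P ⊕ Q) σ) where

  private
    σ-inj = proj₁ σ-linExt
    σ-mono = proj₂ (proj₂ σ-linExt)

  left-values-≤-right : (a : Fin m) (b : Fin n) → toℕ (σ (a ↑ˡ n)) ≤ toℕ (σ (m ↑ʳ b))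
  left-values-≤-right a b = ℕ.s≤s⁻¹ (σ-mono _ _ (⊕-across P Q a b))

  -- So σ maps P into the first m positions: otherwise one element of P together with all
  -- n elements of Q would occupy n + 1 distinct positions at or above m.
  left-values-below : (a : Fin m) → toℕ (σ (a ↑ˡ n)) < m
  left-values-below a with toℕ (σ (a ↑ˡ n)) ℕ.<? m
  ... | yes below = below
  ... | no ¬below = ⊥-elim (ℕₚ.1+n≰n (injection-above (σ ∘ points) points-inj above))
    where
    points = (a ↑ˡ n) VecF.∷ (m ↑ʳ_)
    points-inj : ∀ i j → σ (points i) ≡ σ (points j) → i ≡ j
    points-inj i j eq = ∷-injective (λ b → ↑ˡ≢↑ʳ a b ∘ sym) (Finₚ.↑ʳ-injective m) i j (σ-inj _ _ eq)
    above : ∀ i → m ≤ toℕ (σ (points i))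
    above Fin.zero    = ℕₚ.≮⇒≥ ¬below
    above (Fin.suc b) = ℕₚ.≤-trans (ℕₚ.≮⇒≥ ¬below) (left-values-≤-right a b)

  right-values-above : (b : Fin n) → m ≤ toℕ (σ (m ↑ʳ b))
  right-values-above b with m ℕ.≤? toℕ (σ (m ↑ʳ b))
  ... | yes above = above
  ... | no ¬above = ⊥-elim (ℕₚ.1+n≰n (injection-below (σ ∘ points) points-inj below))
    where
    points = (m ↑ʳ b) VecF.∷ (_↑ˡ n)
    points-inj : ∀ i j → σ (points i) ≡ σ (points j) → i ≡ j
    points-inj i j eq = ∷-injective (λ a → ↑ˡ≢↑ʳ a b) (Finₚ.↑ˡ-injective n) i j (σ-inj _ _ eq)
    below : ∀ i → toℕ (σ (points i)) < m
    below Fin.zero    = ℕₚ.≰⇒> ¬above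
    below (Fin.suc a) = ℕₚ.≤-<-trans (left-values-≤-right a b) (ℕₚ.≰⇒> ¬above)

  linExt-is-stack : ∃ λ s → ∃ λ t → ∀ i → σ i ≡ stack s t i
  linExt-is-stack = s , t , σ≗stack
    where
    s = λ a → proj₁ (left-of (σ (a ↑ˡ n)) (left-values-below a))
    t = λ b → proj₁ (right-of (σ (m ↑ʳ b)) (right-values-above b))
    σ≗stack : ∀ i → σ i ≡ stack s t i
    σ≗stack i with side m n i
    ... | left a  = trans (sym (proj₂ (left-of (σ (a ↑ˡ n)) (left-values-below a)))) (sym (stack-left a))
    ... | right b = trans (sym (proj₂ (right-of (σ (m ↑ʳ b)) (right-values-above b)))) (sym (stack-right b))

linExt-cong : (R : DecRel k) {σ τ : Fin k → Fin k} → (∀ i → σ i ≡ τ i) → IsLinExt R σ → IsLinExt R τ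
linExt-cong R σ≗τ (inj , onto , mono) =
  (λ i j eq → inj i j (trans (σ≗τ i) (trans eq (sym (σ≗τ j))))) ,
  (λ c → proj₁ (onto c) , trans (sym (σ≗τ (proj₁ (onto c)))) (proj₂ (onto c))) ,
  (λ i j i≤j → subst₂ _≤_ (cong (suc ∘ toℕ) (σ≗τ i)) (cong (suc ∘ toℕ) (σ≗τ j)) (mono i j i≤j))

weight-cong : (R : DecRel k) {σ τ : Fin k → Fin k} → (∀ i → σ i ≡ τ i) → weight R σ ≡ weight R τ
weight-cong R {σ} {τ} σ≗τ = cong sumℚ (Listₚ.map-cong (λ i → cong (λ x → H (x ∸ 1)) (d-equal i)) (allFin _))
  where
  d-equal : ∀ i → d R σ i ≡ d R τ i
  d-equal i = trans (d-as-max R σ i) (trans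
    (cong₂ (λ x vs → x ∸ maxℕ vs) (cong (suc ∘ toℕ) (σ≗τ i))
           (Listₚ.map-cong (cong (suc ∘ toℕ) ∘ σ≗τ) (preds R i)))
    (sym (d-as-max R τ i)))

allTables-suc : ∀ k m → allTables (suc k) m ≡ cartesianProductWith _∷ᵥ_ (allFin m) (allTables k m)
allTables-suc k m = concatMap-map (allFin m)
  where
  concatMap-map : ∀ xs → List.concatMap (λ x → map (x ∷ᵥ_) (allTables k m)) xs
                          ≡ cartesianProductWith _∷ᵥ_ xs (allTables k m)
  concatMap-map []       = refl
  concatMap-map (x ∷ xs) = cong (map (x ∷ᵥ_) (allTables k m) ++_) (concatMap-map xs)

allTables-complete : (v : Vec (Fin m) k) → v ∈ allTables k m
allTables-complete Vec.[] = here refl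
allTables-complete {m} {suc k} (x ∷ᵥ v) = subst (x ∷ᵥ v ∈_) (sym (allTables-suc k m))
  (∈-cartesianProductWith⁺ _∷ᵥ_ (∈-allFin x) (allTables-complete v))

allTables-unique : ∀ k m → Unique (allTables k m)
allTables-unique zero    m = [] AllPairs.∷ AllPairs.[]
allTables-unique (suc k) m = subst Unique (sym (allTables-suc k m))
  (Uniqueₚ.cartesianProductWith⁺ _∷ᵥ_ Vecₚ.∷-injective (Uniqueₚ.allFin⁺ m) (allTables-unique k m))

module _ (R : DecRel k) where

  ∈Δ⁺ : {v : Vec (Fin k) k} → IsLinExt R (lookup v) → v ∈ Δ R
  ∈Δ⁺ {v} = ∈-filter⁺ (λ t → isLinExt? R (lookup t)) (allTables-complete v)

  ∈Δ⁻ : {v : Vec (Fin k) k} → v ∈ Δ R → IsLinExt R (lookup v)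
  ∈Δ⁻ v∈ = proj₂ (∈-filter⁻ (λ t → isLinExt? R (lookup t)) {xs = allTables k k} v∈)

  Δ-unique : Unique (Δ R)
  Δ-unique = Uniqueₚ.filter⁺ (λ t → isLinExt? R (lookup t)) (allTables-unique k k)

stackᵥ : Vec (Fin m) m → Vec (Fin n) n → Vec (Fin (m + n)) (m + n)
stackᵥ s t = Vec.tabulate (stack (lookup s) (lookup t))

lookup-stackᵥ : (s : Vec (Fin m) m) (t : Vec (Fin n) n) → ∀ i → lookup (stackᵥ s t) i ≡ stack (lookup s) (lookup t) i
lookup-stackᵥ s t = Vecₚ.lookup∘tabulate (stack (lookup s) (lookup t))

vec-ext : (u v : Vec A k) → (∀ i → lookup u i ≡ lookup v i) → u ≡ v
vec-ext u v u≗v = trans (sym (Vecₚ.tabulate∘lookup u)) (trans (Vecₚ.tabulate-cong u≗v) (Vecₚ.tabulate∘lookup v))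

stackᵥ-injective : ∀ {s s′ : Vec (Fin m) m} {t t′ : Vec (Fin n) n} →
  stackᵥ s t ≡ stackᵥ s′ t′ → s ≡ s′ × t ≡ t′
stackᵥ-injective {m} {n} {s} {s′} {t} {t′} eq =
  vec-ext s s′ (λ a → Finₚ.↑ˡ-injective n _ _ (at (a ↑ˡ n) (stack-left a) (stack-left a))) ,
  vec-ext t t′ (λ b → Finₚ.↑ʳ-injective m _ _ (at (m ↑ʳ b) (stack-right b) (stack-right b)))
  where
  at : ∀ {x y} i → stack (lookup s) (lookup t) i ≡ x → stack (lookup s′) (lookup t′) i ≡ y → x ≡ y
  at i p q = trans (sym p) (trans (sym (lookup-stackᵥ s t i))
               (trans (cong (λ v → lookup v i) eq) (trans (lookup-stackᵥ s′ t′ i) q)))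

module _ (P : DecRel m) (Q : DecRel n) where

  -- Δ(P ⊕ Q) is a permutation of the product list Δ P × Δ Q: both are duplicate-free and, by
  -- the stacking lemmas, have the same members.
  Δ-⊕ : Δ (P ⊕ Q) ↭ cartesianProductWith stackᵥ (Δ P) (Δ Q)
  Δ-⊕ = ∼bag⇒↭ (unique∧set⇒bag (Δ-unique (P ⊕ Q)) stacks-unique (mk⇔ to from))
    where
    stacks-unique : Unique (cartesianProductWith stackᵥ (Δ P) (Δ Q))
    stacks-unique = Uniqueₚ.cartesianProductWith⁺ stackᵥ stackᵥ-injective (Δ-unique P) (Δ-unique Q)

    to : ∀ {v} → v ∈ Δ (P ⊕ Q) → v ∈ cartesianProductWith stackᵥ (Δ P) (Δ Q)
    to {v} v∈ with linExt-is-stack P Q (∈Δ⁻ (P ⊕ Q) v∈)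
    ... | s , t , v≗stack = subst (_∈ _) (sym v≡stack)
      (∈-cartesianProductWith⁺ stackᵥ (∈Δ⁺ P {sᵥ} sᵥ-ext) (∈Δ⁺ Q {tᵥ} tᵥ-ext))
      where
      sᵥ = Vec.tabulate s
      tᵥ = Vec.tabulate t
      parts = unstack-linExt {P = P} {Q = Q} (linExt-cong (P ⊕ Q) v≗stack (∈Δ⁻ (P ⊕ Q) v∈))
      sᵥ-ext : IsLinExt P (lookup sᵥ)
      sᵥ-ext = linExt-cong P (sym ∘ Vecₚ.lookup∘tabulate s) (proj₁ parts)
      tᵥ-ext : IsLinExt Q (lookup tᵥ)
      tᵥ-ext = linExt-cong Q (sym ∘ Vecₚ.lookup∘tabulate t) (proj₂ parts)
      v≡stack : v ≡ stackᵥ sᵥ tᵥ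
      v≡stack = vec-ext v (stackᵥ sᵥ tᵥ) (λ i → trans (v≗stack i) (trans
        (stack-cong (sym ∘ Vecₚ.lookup∘tabulate s) (sym ∘ Vecₚ.lookup∘tabulate t) i)
        (sym (lookup-stackᵥ sᵥ tᵥ i))))

    from : ∀ {v} → v ∈ cartesianProductWith stackᵥ (Δ P) (Δ Q) → v ∈ Δ (P ⊕ Q)
    from v∈ with ∈-cartesianProductWith⁻ stackᵥ (Δ P) (Δ Q) v∈
    ... | s , t , s∈ , t∈ , refl = ∈Δ⁺ (P ⊕ Q)
      (linExt-cong (P ⊕ Q) (sym ∘ lookup-stackᵥ s t) (stack-linExt (∈Δ⁻ P s∈) (∈Δ⁻ Q t∈)))

  weight-stackᵥ : ∀ {s} → s ∈ Δ P → ∀ t →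
    weight (P ⊕ Q) (lookup (stackᵥ s t)) ≡ weight P (lookup s) +ℚ weight Q (lookup t)
  weight-stackᵥ {s} s∈ t = trans (weight-cong (P ⊕ Q) (lookup-stackᵥ s t))
                                  (weight-stack (proj₁ (proj₂ (∈Δ⁻ P s∈))))

length-filter-≤ : ∀ {P Q : Pred A 0ℓ} (P? : Decidable P) (Q? : Decidable Q) → (∀ {x} → P x → Q x) →
  ∀ xs → length (filter P? xs) ≤ length (filter Q? xs)
length-filter-≤ P? Q? P⊆Q []       = z≤n
length-filter-≤ P? Q? P⊆Q (x ∷ xs) with P? x | Q? x
... | yes _  | yes _  = s≤s (length-filter-≤ P? Q? P⊆Q xs)
... | yes px | no ¬qx = ⊥-elim (¬qx (P⊆Q px))
... | no _   | yes _  = ℕₚ.m≤n⇒m≤1+n (length-filter-≤ P? Q? P⊆Q xs)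
... | no _   | no _   = length-filter-≤ P? Q? P⊆Q xs

length-filter-< : ∀ {P Q : Pred A 0ℓ} (P? : Decidable P) (Q? : Decidable Q) → (∀ {x} → P x → Q x) →
  ∀ {y} xs → y ∈ xs → Q y → ¬ P y → length (filter P? xs) < length (filter Q? xs)
length-filter-< P? Q? P⊆Q (x ∷ xs) (here refl) qy ¬py with P? x | Q? x
... | yes px | _      = ⊥-elim (¬py px)
... | no _   | yes _  = s≤s (length-filter-≤ P? Q? P⊆Q xs)
... | no _   | no ¬qy = ⊥-elim (¬qy qy)
length-filter-< P? Q? P⊆Q (x ∷ xs) (there y∈) qy ¬py with P? x | Q? x
... | yes _  | yes _  = s≤s (length-filter-< P? Q? P⊆Q xs y∈ qy ¬py)
... | yes px | no ¬qx = ⊥-elim (¬qx (P⊆Q px))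
... | no _   | yes _  = ℕₚ.m≤n⇒m≤1+n (length-filter-< P? Q? P⊆Q xs y∈ qy ¬py)
... | no _   | no _   = length-filter-< P? Q? P⊆Q xs y∈ qy ¬py

injective⇒onto : (f : Fin k → Fin k) → (∀ i j → f i ≡ f j → i ≡ j) → ∀ c → ∃ λ i → f i ≡ c
injective⇒onto {suc k} f f-inj c with Finₚ.any? (λ i → f i Finₚ.≟ c)
... | yes hit = hit
... | no miss = ⊥-elim (ℕₚ.1+n≰n (Finₚ.injective⇒≤ {f = λ i → Fin.punchOut (missed i)}
                  (λ {i} {j} eq → f-inj i j (Finₚ.punchOut-injective (missed i) (missed j) eq))))
  where
  missed : ∀ i → c ≢ f i
  missed i c≡fi = miss (i , sym c≡fi)

module _ {_≺_ : Rel (Fin k) 0ℓ} (_≺?_ : Binary.Decidable _≺_)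
         (≺-irrefl : ∀ {i} → ¬ i ≺ i) (≺-trans : ∀ {i j l} → i ≺ j → j ≺ l → i ≺ l) where

  rank : Fin k → Fin k
  rank i = fromℕ< (subst (length (filter (_≺? i) (allFin k)) <_) (Listₚ.length-tabulate id)
    (Listₚ.filter-notAll (_≺? i) (allFin k) (Any.map (λ { refl → ≺-irrefl }) (∈-allFin i))))

  rank-mono : ∀ {i j} → i ≺ j → toℕ (rank i) < toℕ (rank j)
  rank-mono {i} {j} i≺j = subst₂ _<_ (sym (Finₚ.toℕ-fromℕ< _)) (sym (Finₚ.toℕ-fromℕ< _))
    (length-filter-< (_≺? i) (_≺? j) (λ x≺i → ≺-trans x≺i i≺j) (allFin k) (∈-allFin i) i≺j ≺-irrefl)

  rank-injective : (∀ {i j} → i ≢ j → i ≺ j ⊎ j ≺ i) → ∀ i j → rank i ≡ rank j → i ≡ j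
  rank-injective ≺-connex i j eq with i Finₚ.≟ j
  ... | yes i≡j = i≡j
  ... | no i≢j with ≺-connex i≢j
  ...   | inj₁ i≺j = ⊥-elim (ℕₚ.<-irrefl (cong toℕ eq) (rank-mono i≺j))
  ...   | inj₂ j≺i = ⊥-elim (ℕₚ.<-irrefl (cong toℕ (sym eq)) (rank-mono j≺i))

module _ (R : DecRel k) (R-poset : IsPoset R) where

  private module R = IsPartialOrder R-poset

  downset-size : Fin k → ℕ
  downset-size i = length (filter (λ j → _≤?_ R j i) (allFin k))

  downset-size-mono : ∀ {i j} → _≤ᴿ_ R i j → i ≢ j → downset-size i < downset-size j
  downset-size-mono {i} {j} i≤j i≢j = length-filter-< (λ x → _≤?_ R x i) (λ x → _≤?_ R x j)
    (λ x≤i → R.trans x≤i i≤j) (allFin k) (∈-allFin j) R.refl (λ j≤i → i≢j (R.antisym i≤j j≤i))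

  private
    code : Fin k → ℕ × ℕ
    code i = downset-size i , toℕ i

    _≺_ : Rel (Fin k) 0ℓ
    i ≺ j = ×-Lex _≡_ _<_ _<_ (code i) (code j)

    _≺?_ : Binary.Decidable _≺_
    i ≺? j = Lex.×-decidable ℕ._≟_ ℕ._<?_ ℕ._<?_ (code i) (code j)

    ≺-irrefl : ∀ {i} → ¬ i ≺ i
    ≺-irrefl {i} = Lex.×-irreflexive {_≈₁_ = _≡_} {_<₁_ = _<_} {_≈₂_ = _≡_} {_<₂_ = _<_}
      ℕₚ.<-irrefl ℕₚ.<-irrefl {code i} {code i} (refl , refl)

    ≺-trans : ∀ {i j l} → i ≺ j → j ≺ l → i ≺ l
    ≺-trans {i} {j} {l} = Lex.×-transitive {_≈₁_ = _≡_} {_<₁_ = _<_} {_<₂_ = _<_}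
      isEquivalence ℕₚ.<-resp₂-≡ ℕₚ.<-trans ℕₚ.<-trans {code i} {code j} {code l}

    ≺-connex : ∀ {i j} → i ≢ j → i ≺ j ⊎ j ≺ i
    ≺-connex {i} {j} i≢j with Lex.×-compare sym ℕₚ.<-cmp ℕₚ.<-cmp (code i) (code j)
    ... | tri< i≺j _ _ = inj₁ i≺j
    ... | tri≈ _ (_ , same-index) _ = ⊥-elim (i≢j (Finₚ.toℕ-injective same-index))
    ... | tri> _ _ j≺i = inj₂ j≺i

  linExt-exists : ∃ λ σ → IsLinExt R σ
  linExt-exists = σ , σ-inj , injective⇒onto σ σ-inj , σ-mono
    where
    σ = rank _≺?_ ≺-irrefl ≺-trans
    σ-inj = rank-injective _≺?_ ≺-irrefl ≺-trans ≺-connex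
    σ-mono : ∀ i j → _≤ᴿ_ R i j → val σ i ≤ val σ j
    σ-mono i j i≤j with i Finₚ.≟ j
    ... | yes refl = ℕₚ.≤-refl
    ... | no i≢j   = s≤s (ℕₚ.<⇒≤ (rank-mono _≺?_ ≺-irrefl ≺-trans (inj₁ (downset-size-mono i≤j i≢j))))

Δ-nonempty : (R : DecRel k) → IsPoset R → ∃ λ p → length (Δ R) ≡ suc p
Δ-nonempty R R-poset with linExt-exists R R-poset
... | σ , σ-linExt = nonempty (∈Δ⁺ R {Vec.tabulate σ} (linExt-cong R (sym ∘ Vecₚ.lookup∘tabulate σ) σ-linExt))
  where
  nonempty : ∀ {v : Vec (Fin k) k} {vs} → v ∈ vs → ∃ λ p → length vs ≡ suc p
  nonempty {vs = _ ∷ vs} _ = length vs , refl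

lemma10 : {m n : ℕ} (P : DecRel m) (Q : DecRel n) → IsPoset P → IsPoset Q →
    QLB (P ⊕ Q) ≡ QLB P +ℚ QLB Q
lemma10 P Q P-poset Q-poset = begin
  avg (map (w (P ⊕ Q)) (Δ (P ⊕ Q)))                                 ≡⟨ avg-↭ (Permₚ.map⁺ (w (P ⊕ Q)) (Δ-⊕ P Q)) ⟩
  avg (map (w (P ⊕ Q)) (cartesianProductWith stackᵥ (Δ P) (Δ Q)))
    ≡⟨ cong avg (map-cartesianProductWith (w (P ⊕ Q)) stackᵥ _ (Δ P) (Δ Q) (weight-stackᵥ P Q)) ⟩
  avg (cartesianProductWith (λ s t → w P s +ℚ w Q t) (Δ P) (Δ Q))
    ≡⟨ avg-cartesian (w P) (w Q) (Δ P) (Δ Q) (proj₂ (Δ-nonempty P P-poset)) (proj₂ (Δ-nonempty Q Q-poset)) ⟩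
  avg (map (w P) (Δ P)) +ℚ avg (map (w Q) (Δ Q))                   ∎
  where
  open ≡-Reasoning
  w : (R : DecRel k) → Vec (Fin k) k → ℚ
  w R = weight R ∘ lookup
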